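{- Let $G=(V,E)$ be a graph, let $\langle c,x\rangle\geqslant\lambda$ be a facet-defining inequality for $\mathrm{CUT}(G)$ with $\lambda>0$ and $c(e)\neq 0$ for every $e\in E$, and let $\mathcal F$ be a family of subsets of $V$ such that $\{\delta(S): S\in\mathcal F\}$ is a basis of minimum cuts. Then: (i) for every $S\in\mathcal F$, the induced subgraphs $G[S]$ and $G[V\smallsetminus S]$ are both connected; (ii) $G$ is simple (no loops, no parallel edges); (iii) for every $e\in E$ there is at least one $S\in\mathcal F$ with $e\in\delta(S)$.
   Context: Graphs are finite, undirected, may have loops and parallel edges, and have at least two nodes. For $S\subseteq V$, $\delta(S)$ is the set of edges with exactly one endnode in $S$; $\chi^F\in\{0,1\}^E$ denotes the characteristic vector of $F\subseteq E$, and $c(F)=\sum_{e\in F}c(e)$. The cut dominant is $\mathrm{CUT}(G)=\mathrm{conv}\{\chi^{\delta(S)} : \varnothing\neq S\subsetneq V\}+\mathbb{R}^E_+$. For $c\in\mathbb{R}^E_+$, $\lambda^c(G)$ is the minimum of $c(\delta(S))$ over $\varnothing\neq S\subsetneq V$; a cut $\delta(S)$ with $\varnothing\neq S\subsetneq V$ and $c(\delta(S))=\lambda^c(G)$ is a minimum cut (with respect to $c$). "$\{\delta(S):S\in\mathcal F\}$ is a basis of minimum cuts" means $\mathcal F$ consists of $|E|$ sets $S$ with $\varnothing\neq S\subsetneq V$, each $\delta(S)$ is a minimum cut with respect to $c$, and the vectors $\chi^{\delta(S)}$, $S\in\mathcal F$, are linearly independent.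
   Formalization: The coefficients $c(e)$ and the value $\lambda$ are rational, the points of $\mathrm{CUT}(G)$ have rational coordinates, and linear independence is taken over ℚ, instead of over ℝ. -}

module Defs where

open import Data.Nat using (ℕ; zero; suc)
open import Data.Fin using (Fin; zero; suc)
open import Data.Bool using (Bool; true; false; _xor_; if_then_else_)
open import Data.Product using (_×_; _,_; ∃; ∃-syntax; Σ-syntax)
open import Data.Sum using (_⊎_)
open import Data.Rational using (ℚ; 0ℚ; 1ℚ; _+_; _*_; _≤_; _<_)
open import Relation.Binary.PropositionalEquality using (_≡_)
open import Relation.Nullary using (¬_)

-- A finite graph: nodes Fin n (n ≥ 2), edges Fin m, each edge e has
-- endnodes end₁ e and end₂ e (loops: end₁ e ≡ end₂ e; parallel edges allowed).
record Graph : Set where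
  field
    n      : ℕ
    m      : ℕ
    two≤n  : 2 Data.Nat.≤ n
    end₁   : Fin m → Fin n
    end₂   : Fin m → Fin n
open Graph public

∑ : (k : ℕ) → (Fin k → ℚ) → ℚ
∑ zero    f = 0ℚ
∑ (suc k) f = f zero + ∑ k (λ i → f (suc i))

Vec𝔼 : Graph → Set
Vec𝔼 G = Fin (m G) → ℚ

NodeSet : Graph → Set
NodeSet G = Fin (n G) → Bool

NonTrivial : (G : Graph) → NodeSet G → Set
NonTrivial G S = (∃[ v ] S v ≡ true) × (∃[ v ] S v ≡ false)

δ-bool : (G : Graph) → NodeSet G → Fin (m G) → Bool
δ-bool G S e = S (end₁ G e) xor S (end₂ G e)

_∈δ_ : {G : Graph} → Fin (m G) → NodeSet G → Set
_∈δ_ {G} e S = δ-bool G S e ≡ true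

χδ : (G : Graph) → NodeSet G → Vec𝔼 G
χδ G S e = if δ-bool G S e then 1ℚ else 0ℚ

⟨_,_⟩ : {G : Graph} → Vec𝔼 G → Vec𝔼 G → ℚ
⟨_,_⟩ {G} c x = ∑ (m G) (λ e → c e * x e)

cδ : (G : Graph) → Vec𝔼 G → NodeSet G → ℚ
cδ G c S = ⟨_,_⟩ {G} c (χδ G S)

-- Membership in the cut dominant CUT(G) = conv{χ^δ(S)} + ℚ^E_+ :
-- x is a finite convex combination of cut vectors plus a nonnegative vector.
InCUT : (G : Graph) → Vec𝔼 G → Set
InCUT G x =
  Σ[ k ∈ ℕ ] Σ[ S ∈ (Fin k → NodeSet G) ] Σ[ μ ∈ (Fin k → ℚ) ] Σ[ y ∈ Vec𝔼 G ]
    ((∀ i → NonTrivial G (S i)) ×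
     (∀ i → 0ℚ ≤ μ i) ×
     (∑ k μ ≡ 1ℚ) ×
     (∀ e → 0ℚ ≤ y e) ×
     (∀ e → x e ≡ ∑ k (λ i → μ i * χδ G (S i) e) + y e))

AffinelyIndependent : (G : Graph) (k : ℕ) → (Fin k → Vec𝔼 G) → Set
AffinelyIndependent G k p =
  (a : Fin k → ℚ) →
  (∀ e → ∑ k (λ i → a i * p i e) ≡ 0ℚ) →
  ∑ k a ≡ 0ℚ →
  ∀ i → a i ≡ 0ℚ

Valid : (G : Graph) → Vec𝔼 G → ℚ → Set
Valid G c λ₀ = ∀ x → InCUT G x → λ₀ ≤ ⟨_,_⟩ {G} c x

-- Since CUT(G) ⊆ ℚ^E, a proper face of dimension
-- |E| − 1 is exactly a face of dimension dim CUT(G) − 1.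
FacetDefining : (G : Graph) → Vec𝔼 G → ℚ → Set
FacetDefining G c λ₀ =
  Valid G c λ₀ ×
  (∃[ x ] (InCUT G x × λ₀ < ⟨_,_⟩ {G} c x)) ×
  (Σ[ p ∈ (Fin (m G) → Vec𝔼 G) ]
     ((∀ i → InCUT G (p i)) ×
      (∀ i → ⟨_,_⟩ {G} c (p i) ≡ λ₀) ×
      AffinelyIndependent G (m G) p))

IsMinCut : (G : Graph) → Vec𝔼 G → NodeSet G → Set
IsMinCut G c S =
  NonTrivial G S × (∀ T → NonTrivial G T → cδ G c S ≤ cδ G c T)

BasisOfMinCuts : (G : Graph) → Vec𝔼 G → (Fin (m G) → NodeSet G) → Set
BasisOfMinCuts G c ℱ =
  (∀ i → IsMinCut G c (ℱ i)) ×
  ((a : Fin (m G) → ℚ) →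
     (∀ e → ∑ (m G) (λ i → a i * χδ G (ℱ i) e) ≡ 0ℚ) →
     ∀ i → a i ≡ 0ℚ)

∁ : {G : Graph} → NodeSet G → NodeSet G
∁ S v = Data.Bool.not (S v)

data Reach (G : Graph) (S : NodeSet G) : Fin (n G) → Fin (n G) → Set where
  here : ∀ {u} → S u ≡ true → Reach G S u u
  step₁₂ : ∀ {w} (e : Fin (m G)) → S (end₁ G e) ≡ true → S (end₂ G e) ≡ true →
           Reach G S (end₂ G e) w → Reach G S (end₁ G e) w
  step₂₁ : ∀ {w} (e : Fin (m G)) → S (end₁ G e) ≡ true → S (end₂ G e) ≡ true →
           Reach G S (end₁ G e) w → Reach G S (end₂ G e) w

InducedConnected : (G : Graph) → NodeSet G → Set
InducedConnected G S =
  ∀ u v → S u ≡ true → S v ≡ true → Reach G S u v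

Simple : Graph → Set
Simple G =
  (∀ e → ¬ (end₁ G e ≡ end₂ G e)) ×
  (∀ e f → ¬ (e ≡ f) →
     ¬ ((end₁ G e ≡ end₁ G f × end₂ G e ≡ end₂ G f) ⊎
        (end₁ G e ≡ end₂ G f × end₂ G e ≡ end₁ G f)))

module Submission where

-- Validity of ⟨c,x⟩ ≥ λ on the cut vectors gives λ ≤ c(δ(T)) for all
-- nontrivial T; the basis property says the m = |E| vectors χ^{δ(S)}, S ∈ ℱ,
-- are linearly independent in ℚ^E.  Nothing else is used.
-- (i) If G[P] is disconnected for a minimum shore P, let A be the component
--     of some u in G[P] (the stationary stage of breadth-first search) and
--     B = P ∖ A ≠ ∅.  No edge of G[P] joins A to B, so c(δ(P)) =
--     c(δ(A)) + c(δ(B)) ≥ c(δ(A)) + λ > c(δ(A)), contradicting minimality.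
--     As δ(V ∖ P) = δ(P), V ∖ P is a minimum shore too.
-- (ii),(iii) Deleting coordinate f from m independent vectors in ℚ^m leaves
--     m dependent vectors in ℚ^{m-1} (Gaussian elimination), giving a
--     combination vanishing off f but not at f.  So no coordinate vanishes on
--     all vectors (every edge is in some δ(S)), no two coordinates agree on all
--     of them (no parallel edges), and loops, lying in no cut, cannot occur.

open import Defs
open import Data.Nat as ℕ using (ℕ; zero; suc; z≤n; s≤s)
import Data.Nat.Properties as ℕP
open import Data.Fin using (Fin; zero; suc; punchIn; punchOut)
open import Data.Fin.Properties using (any?; punchIn-punchOut) renaming (_≟_ to _≟ᶠ_)
open import Data.Fin.Subset using (Subset; _⊂_; ∣_∣) renaming (_∈_ to _∈ˢ_)
open import Data.Fin.Subset.Properties using (p⊂q⇒∣p∣<∣q∣; ∣p∣≤n)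
open import Data.Bool using (Bool; true; false; _xor_; _∧_; _∨_; not; if_then_else_)
open import Data.Bool.Properties as BoolP using (¬-not; xor-same; xor-comm; not-distribˡ-xor; not-distribʳ-xor; not-involutive)
open import Data.Vec using (tabulate)
open import Data.Vec.Properties using (lookup∘tabulate; []=⇒lookup; lookup⇒[]=)
open import Data.Vec.Functional using (tail; insertAt)
open import Data.Vec.Functional.Properties using (insertAt-lookup; insertAt-punchIn)
open import Data.Product using (_×_; _,_; ∃-syntax; Σ-syntax; proj₂)
open import Data.Sum using (_⊎_; inj₁; inj₂)
open import Data.Empty using (⊥-elim)
open import Data.Rational using (ℚ; 0ℚ; 1ℚ; _+_; _*_; -_; _≤_; _<_; 1/_; ≢-nonZero)
import Data.Rational.Properties as ℚP
open import Data.Rational.Solver using (module +-*-Solver)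
open +-*-Solver using (solve; _:+_; _:*_; :-_; _:=_; con)
open import Algebra.Bundles using (CommutativeRing)
open import Algebra.Properties.Semiring.Sum (CommutativeRing.semiring ℚP.+-*-commutativeRing)
  using (sum; sum-cong-≗; sum-replicate-zero; ∑-distrib-+; *-distribˡ-sum; sum-remove)
open import Function using (_∘_)
open import Relation.Binary.PropositionalEquality
  using (_≡_; _≢_; refl; sym; trans; cong; cong₂; subst; module ≡-Reasoning)
open import Relation.Nullary using (¬_; ¬?; yes; no; Dec; does)
open import Relation.Nullary.Decidable using (_×-dec_; _⊎-dec_; decidable-stable)

∑≡sum : ∀ k (f : Fin k → ℚ) → ∑ k f ≡ sum f
∑≡sum zero    f = refl
∑≡sum (suc k) f = cong (f zero +_) (∑≡sum k (f ∘ suc))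

viaSum : ∀ k {f g : Fin k → ℚ} → sum f ≡ sum g → ∑ k f ≡ ∑ k g
viaSum k {f} {g} eq = trans (∑≡sum k f) (trans eq (sym (∑≡sum k g)))

∑-cong : ∀ k {f g : Fin k → ℚ} → (∀ i → f i ≡ g i) → ∑ k f ≡ ∑ k g
∑-cong k f≗g = viaSum k (sum-cong-≗ f≗g)

∑-zero : ∀ k → ∑ k (λ _ → 0ℚ) ≡ 0ℚ
∑-zero k = trans (∑≡sum k _) (sum-replicate-zero k)

∑-+ : ∀ k (f g : Fin k → ℚ) → ∑ k (λ i → f i + g i) ≡ ∑ k f + ∑ k g
∑-+ k f g = trans (∑≡sum k _) (trans (∑-distrib-+ f g)
                  (cong₂ _+_ (sym (∑≡sum k f)) (sym (∑≡sum k g))))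

∑-scale : ∀ k (x : ℚ) (f : Fin k → ℚ) → ∑ k (λ i → x * f i) ≡ x * ∑ k f
∑-scale k x f = trans (∑≡sum k _) (trans (sym (*-distribˡ-sum x f)) (cong (x *_) (sym (∑≡sum k f))))

∑-remove : ∀ k (f : Fin (suc k) → ℚ) (i : Fin (suc k)) →
           ∑ (suc k) f ≡ f i + ∑ k (f ∘ punchIn i)
∑-remove k f i = trans (∑≡sum (suc k) f) (trans (sum-remove f) (cong (f i +_) (sym (∑≡sum k _))))

combination : ∀ {k d} → (Fin k → ℚ) → (Fin k → Fin d → ℚ) → Fin d → ℚ
combination {k} a v x = ∑ k (λ i → a i * v i x)

LinearlyIndependent : ∀ {k d} → (Fin k → Fin d → ℚ) → Set
LinearlyIndependent v = ∀ a → (∀ x → combination a v x ≡ 0ℚ) → ∀ i → a i ≡ 0ℚ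

Dependency : ∀ {k d} → (Fin k → Fin d → ℚ) → Set
Dependency {k} v =
  Σ[ a ∈ (Fin k → ℚ) ] ((∃[ i ] a i ≢ 0ℚ) × (∀ x → combination a v x ≡ 0ℚ))

combination-zeroColumn : ∀ {k d} a (v : Fin k → Fin d → ℚ) x →
                         (∀ i → v i x ≡ 0ℚ) → combination a v x ≡ 0ℚ
combination-zeroColumn {k} a v x zeroColumn =
  trans (∑-cong k (λ i → trans (cong (a i *_) (zeroColumn i)) (ℚP.*-zeroʳ (a i)))) (∑-zero k)

combination-insertAt : ∀ {k d} (b : Fin k → ℚ) (i₀ : Fin (suc k)) (α : ℚ)
                       (v : Fin (suc k) → Fin d → ℚ) x →
  combination (insertAt b i₀ α) v x ≡ α * v i₀ x + combination b (v ∘ punchIn i₀) x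
combination-insertAt {k} b i₀ α v x =
  trans (∑-remove k (λ i → insertAt b i₀ α i * v i x) i₀)
        (cong₂ _+_ (cong (_* v i₀ x) (insertAt-lookup b i₀ α))
                   (∑-cong k (λ j → cong (_* v (punchIn i₀ j) x) (insertAt-punchIn b i₀ α j))))

dependency-zeroHead : ∀ {k d} (v : Fin k → Fin (suc d) → ℚ) → (∀ i → v i zero ≡ 0ℚ) →
                      Dependency (tail ∘ v) → Dependency v
dependency-zeroHead v zeroHead (a , nontrivial , vanish) = a , nontrivial , vanish′
  where
  vanish′ : ∀ x → combination a v x ≡ 0ℚ
  vanish′ zero    = combination-zeroColumn a v zero zeroHead
  vanish′ (suc x) = vanish x

-- Gaussian elimination with pivot p = v i₀ 0 and r = -1/p: every other
-- vector u gets u + (r · u 0) · v i₀ (its first coordinate becomes 0, which is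
-- dropped).
eliminate : ∀ {k d} → (Fin (suc k) → Fin (suc d) → ℚ) → Fin (suc k) → ℚ → Fin k → Fin d → ℚ
eliminate v i₀ r j x = v (punchIn i₀ j) (suc x) + v (punchIn i₀ j) zero * (r * v i₀ (suc x))

∑-affine : ∀ k (b p q : Fin k → ℚ) (t : ℚ) →
  ∑ k (λ j → b j * (p j + q j * t)) ≡ ∑ k (λ j → b j * p j) + t * ∑ k (λ j → b j * q j)
∑-affine k b p q t = begin
  ∑ k (λ j → b j * (p j + q j * t))             ≡⟨ ∑-cong k (λ j → distribute (b j) (p j) (q j) t) ⟩
  ∑ k (λ j → b j * p j + t * (b j * q j))       ≡⟨ ∑-+ k _ _ ⟩
  ∑ k (λ j → b j * p j) + ∑ k (λ j → t * (b j * q j))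
                                               ≡⟨ cong (∑ k (λ j → b j * p j) +_) (∑-scale k t _) ⟩
  ∑ k (λ j → b j * p j) + t * ∑ k (λ j → b j * q j) ∎
  where
  open ≡-Reasoning
  distribute : ∀ b p q t → b * (p + q * t) ≡ b * p + t * (b * q)
  distribute = solve 4 (λ b p q t → b :* (p :+ q :* t) := b :* p :+ t :* (b :* q)) refl

-- A dependency among the eliminated vectors lifts to one among the originals:
-- the pivot vector receives the coefficient r · s, s = ∑ bⱼ uⱼ 0.
dependency-pivot : ∀ {k d} (v : Fin (suc k) → Fin (suc d) → ℚ) (i₀ : Fin (suc k)) (r : ℚ) →
                   r * v i₀ zero ≡ - 1ℚ → Dependency (eliminate v i₀ r) → Dependency v
dependency-pivot {k} v i₀ r r·p≡-1 (b , (j , bⱼ≢0) , vanish) =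
  a , (punchIn i₀ j , bⱼ≢0 ∘ trans (sym (insertAt-punchIn b i₀ (r * s) j))) , vanish′
  where
  open ≡-Reasoning
  u = v ∘ punchIn i₀
  s = combination b u zero
  a = insertAt b i₀ (r * s)
  vanish′ : ∀ x → combination a v x ≡ 0ℚ
  vanish′ zero = begin
    combination a v zero              ≡⟨ combination-insertAt b i₀ (r * s) v zero ⟩
    r * s * v i₀ zero + s             ≡⟨ regroup r s (v i₀ zero) ⟩
    (r * v i₀ zero) * s + s           ≡⟨ cong (λ t → t * s + s) r·p≡-1 ⟩
    - 1ℚ * s + s                      ≡⟨ cancel s ⟩
    0ℚ                                ∎
    where
    regroup : ∀ r s p → r * s * p + s ≡ (r * p) * s + s
    regroup = solve 3 (λ r s p → r :* s :* p :+ s := (r :* p) :* s :+ s) refl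
    cancel : ∀ s → - 1ℚ * s + s ≡ 0ℚ
    cancel = solve 1 (λ s → (:- con 1ℚ) :* s :+ s := con 0ℚ) refl
  vanish′ (suc x) = begin
    combination a v (suc x)                      ≡⟨ combination-insertAt b i₀ (r * s) v (suc x) ⟩
    r * s * t + combination b u (suc x)          ≡⟨ swap (combination b u (suc x)) r s t ⟩
    combination b u (suc x) + (r * t) * s        ≡⟨ sym (∑-affine k b (λ j → u j (suc x)) (λ j → u j zero) (r * t)) ⟩
    combination b (eliminate v i₀ r) x           ≡⟨ vanish x ⟩
    0ℚ                                           ∎
    where
    t = v i₀ (suc x)
    swap : ∀ c r s t → r * s * t + c ≡ c + (r * t) * s
    swap = solve 4 (λ c r s t → r :* s :* t :+ c := c :+ (r :* t) :* s) refl

negatedInverse : ∀ p → p ≢ 0ℚ → Σ[ r ∈ ℚ ] r * p ≡ - 1ℚ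
negatedInverse p p≢0 = - (1/ p) , trans (sym (ℚP.neg-distribˡ-* (1/ p) p)) (cong -_ (ℚP.*-inverseˡ p))
  where instance _ = ≢-nonZero p≢0

dependent : ∀ {d k} → d ℕ.< k → (v : Fin k → Fin d → ℚ) → Dependency v
dependent {zero}  {suc k} _          v = (λ _ → 1ℚ) , (zero , λ ()) , λ ()
dependent {suc d} {suc k} (s≤s d<k) v with any? (λ i → ¬? (v i zero ℚP.≟ 0ℚ))
... | yes (i₀ , p≢0) with negatedInverse (v i₀ zero) p≢0
...   | r , r·p≡-1 = dependency-pivot v i₀ r r·p≡-1 (dependent d<k (eliminate v i₀ r))
dependent {suc d} {suc k} (s≤s d<k) v | no noPivot =
  dependency-zeroHead v zeroHead (dependent (ℕP.m≤n⇒m≤1+n d<k) (tail ∘ v))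
  where
  zeroHead : ∀ i → v i zero ≡ 0ℚ
  zeroHead i = decidable-stable (v i zero ℚP.≟ 0ℚ) (λ ne → noPivot (i , ne))

isolating : ∀ {k} (v : Fin k → Fin k → ℚ) → LinearlyIndependent v → (f : Fin k) →
  Σ[ a ∈ (Fin k → ℚ) ] ((∀ e → f ≢ e → combination a v e ≡ 0ℚ) × combination a v f ≢ 0ℚ)
isolating {suc k} v independent f with dependent (ℕP.n<1+n k) (λ i x → v i (punchIn f x))
... | a , (i , aᵢ≢0) , vanish = a , offF , λ atF → aᵢ≢0 (independent a (everywhere atF) i)
  where
  offF : ∀ e → f ≢ e → combination a v e ≡ 0ℚ
  offF e f≢e = subst (λ e′ → combination a v e′ ≡ 0ℚ) (punchIn-punchOut f≢e) (vanish (punchOut f≢e))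
  everywhere : combination a v f ≡ 0ℚ → ∀ e → combination a v e ≡ 0ℚ
  everywhere atF e with f ≟ᶠ e
  ... | yes refl = atF
  ... | no f≢e   = offF e f≢e

independent-columnNonzero : ∀ {k} (v : Fin k → Fin k → ℚ) → LinearlyIndependent v →
                            ∀ f → ¬ (∀ i → v i f ≡ 0ℚ)
independent-columnNonzero v independent f zeroColumn with isolating v independent f
... | a , _ , atF≢0 = atF≢0 (combination-zeroColumn a v f zeroColumn)

independent-columnsDistinct : ∀ {k} (v : Fin k → Fin k → ℚ) → LinearlyIndependent v →
                              ∀ e f → e ≢ f → ¬ (∀ i → v i e ≡ v i f)
independent-columnsDistinct {k} v independent e f e≢f sameColumn with isolating v independent f
... | a , offF , atF≢0 =
  atF≢0 (trans (∑-cong k (λ i → cong (a i *_) (sym (sameColumn i)))) (offF e (e≢f ∘ sym)))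

χ : Bool → ℚ
χ b = if b then 1ℚ else 0ℚ

not-xor-not : ∀ a b → (not a xor not b) ≡ (a xor b)
not-xor-not a b = begin
  not a xor not b     ≡⟨ sym (not-distribˡ-xor a (not b)) ⟩
  not (a xor not b)   ≡⟨ cong not (sym (not-distribʳ-xor a b)) ⟩
  not (not (a xor b)) ≡⟨ not-involutive (a xor b) ⟩
  a xor b             ∎
  where open ≡-Reasoning

-- Endpoint form of χ^{δ(P)} = χ^{δ(A)} + χ^{δ(P∖A)} for A ⊆ P when the
-- edge does not join A to P ∖ A inside P.
χ-split : ∀ p₁ p₂ a₁ a₂ → (a₁ ≡ true → p₁ ≡ true) → (a₂ ≡ true → p₂ ≡ true) →
          (p₁ ≡ true → p₂ ≡ true → a₁ ≡ a₂) →
          χ (p₁ xor p₂) ≡ χ (a₁ xor a₂) + χ ((p₁ ∧ not a₁) xor (p₂ ∧ not a₂))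
χ-split p₁ p₂ true true a⊆p₁ a⊆p₂ _ rewrite a⊆p₁ refl | a⊆p₂ refl = refl
χ-split true  true  false false _ _ _ = refl
χ-split true  false false false _ _ _ = refl
χ-split false true  false false _ _ _ = refl
χ-split false false false false _ _ _ = refl
χ-split p₁ true true false a⊆p₁ _ noJoin with noJoin (a⊆p₁ refl) refl
... | ()
χ-split p₁ false true false a⊆p₁ _ _ rewrite a⊆p₁ refl = refl
χ-split true p₂ false true _ a⊆p₂ noJoin with noJoin refl (a⊆p₂ refl)
... | ()
χ-split false p₂ false true _ a⊆p₂ _ rewrite a⊆p₂ refl = refl

bool-antisym : ∀ {a b} → (a ≡ true → b ≡ true) → (b ≡ true → a ≡ true) → a ≡ b
bool-antisym {true}  {b}     a⇒b _   = sym (a⇒b refl)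
bool-antisym {false} {true}  _   b⇒a = b⇒a refl
bool-antisym {false} {false} _   _   = refl

module _ (G : Graph) where

  _∖_ : NodeSet G → NodeSet G → NodeSet G
  (P ∖ A) w = P w ∧ not (A w)

  cutVector∈CUT : ∀ T → NonTrivial G T → InCUT G (χδ G T)
  cutVector∈CUT T nontrivial =
    1 , (λ _ → T) , (λ _ → 1ℚ) , (λ _ → 0ℚ) , (λ _ → nontrivial) ,
    (λ _ → ℚP.nonNegative⁻¹ 1ℚ) , refl , (λ _ → ℚP.≤-refl) , single
    where
    single : ∀ e → χδ G T e ≡ (1ℚ * χδ G T e + 0ℚ) + 0ℚ
    single e with δ-bool G T e
    ... | true  = refl
    ... | false = refl

  valid⇒lowerBound : ∀ c λ₀ → Valid G c λ₀ → ∀ T → NonTrivial G T → λ₀ ≤ cδ G c T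
  valid⇒lowerBound c λ₀ valid T nontrivial = valid (χδ G T) (cutVector∈CUT T nontrivial)

  δ-complement : ∀ S e → δ-bool G (∁ {G} S) e ≡ δ-bool G S e
  δ-complement S e = not-xor-not (S (end₁ G e)) (S (end₂ G e))

  δ-loop : ∀ S e → end₁ G e ≡ end₂ G e → δ-bool G S e ≡ false
  δ-loop S e loop = trans (cong (λ w → S (end₁ G e) xor S w) (sym loop)) (xor-same (S (end₁ G e)))

  Parallel : Fin (m G) → Fin (m G) → Set
  Parallel e f = (end₁ G e ≡ end₁ G f × end₂ G e ≡ end₂ G f) ⊎
                 (end₁ G e ≡ end₂ G f × end₂ G e ≡ end₁ G f)

  δ-parallel : ∀ S e f → Parallel e f → δ-bool G S e ≡ δ-bool G S f
  δ-parallel S e f (inj₁ (same₁ , same₂)) = cong₂ (λ x y → S x xor S y) same₁ same₂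
  δ-parallel S e f (inj₂ (cross₁ , cross₂)) =
    trans (cong₂ (λ x y → S x xor S y) cross₁ cross₂) (xor-comm (S (end₂ G f)) (S (end₁ G f)))

  independentCuts-cover : (ℱ : Fin (m G) → NodeSet G) → LinearlyIndependent (χδ G ∘ ℱ) →
                          ∀ e → ∃[ i ] (_∈δ_ {G} e (ℱ i))
  independentCuts-cover ℱ independent e with any? (λ i → δ-bool G (ℱ i) e BoolP.≟ true)
  ... | yes found = found
  ... | no none = ⊥-elim (independent-columnNonzero (χδ G ∘ ℱ) independent e zeroColumn)
    where
    zeroColumn : ∀ i → χδ G (ℱ i) e ≡ 0ℚ
    zeroColumn i = cong χ (¬-not (λ e∈δ → none (i , e∈δ)))

  independentCuts-noParallel : (ℱ : Fin (m G) → NodeSet G) → LinearlyIndependent (χδ G ∘ ℱ) →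
                               ∀ e f → e ≢ f → ¬ Parallel e f
  independentCuts-noParallel ℱ independent e f e≢f parallel =
    independent-columnsDistinct (χδ G ∘ ℱ) independent e f e≢f
      (λ i → cong χ (δ-parallel (ℱ i) e f parallel))

  module _ (c : Vec𝔼 G) where

    MinimumShore : NodeSet G → Set
    MinimumShore P = ∀ T → NonTrivial G T → cδ G c P ≤ cδ G c T

    complement-minimum : ∀ P → MinimumShore P → MinimumShore (∁ {G} P)
    complement-minimum P minimum T nontrivial =
      subst (_≤ cδ G c T) (sym sameWeight) (minimum T nontrivial)
      where
      sameWeight : cδ G c (∁ {G} P) ≡ cδ G c P
      sameWeight = ∑-cong (m G) (λ e → cong (λ b → c e * χ b) (δ-complement P e))

    cδ-split : ∀ P A → (∀ w → A w ≡ true → P w ≡ true) →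
               (∀ e → P (end₁ G e) ≡ true → P (end₂ G e) ≡ true → A (end₁ G e) ≡ A (end₂ G e)) →
               cδ G c P ≡ cδ G c A + cδ G c (P ∖ A)
    cδ-split P A A⊆P noJoin =
      trans (∑-cong (m G) (λ e → trans (cong (c e *_) (edgeSplit e)) (ℚP.*-distribˡ-+ (c e) _ _)))
            (∑-+ (m G) _ _)
      where
      edgeSplit : ∀ e → χδ G P e ≡ χδ G A e + χδ G (P ∖ A) e
      edgeSplit e = χ-split (P (end₁ G e)) (P (end₂ G e)) (A (end₁ G e)) (A (end₂ G e))
                            (A⊆P _) (A⊆P _) (noJoin e)

    split-lighter : ∀ λ₀ → 0ℚ < λ₀ → (∀ T → NonTrivial G T → λ₀ ≤ cδ G c T) →
                    ∀ P A → (∀ w → A w ≡ true → P w ≡ true) →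
                    (∀ e → P (end₁ G e) ≡ true → P (end₂ G e) ≡ true → A (end₁ G e) ≡ A (end₂ G e)) →
                    NonTrivial G (P ∖ A) → cδ G c A < cδ G c P
    split-lighter λ₀ 0<λ₀ lowerBound P A A⊆P noJoin nontrivial = begin-strict
      cδ G c A                       ≡⟨ sym (ℚP.+-identityʳ (cδ G c A)) ⟩
      cδ G c A + 0ℚ                  <⟨ ℚP.+-mono-≤-< (ℚP.≤-refl {cδ G c A})
                                           (ℚP.<-≤-trans 0<λ₀ (lowerBound (P ∖ A) nontrivial)) ⟩
      cδ G c A + cδ G c (P ∖ A)      ≡⟨ sym (cδ-split P A A⊆P noJoin) ⟩
      cδ G c P                       ∎
      where open ℚP.≤-Reasoning

reach-trans : ∀ {G S a b d} → Reach G S a b → Reach G S b d → Reach G S a d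
reach-trans (here _)               q = q
reach-trans (step₁₂ e s₁ s₂ walk) q = step₁₂ e s₁ s₂ (reach-trans walk q)
reach-trans (step₂₁ e s₁ s₂ walk) q = step₂₁ e s₁ s₂ (reach-trans walk q)

reach-target : ∀ {G S a b} → Reach G S a b → S b ≡ true
reach-target (here s)               = s
reach-target (step₁₂ _ _ _ walk) = reach-target walk
reach-target (step₂₁ _ _ _ walk) = reach-target walk

-- An ascending chain of subsets of a finite set has a stationary step.
-- (Along a strictly ascending stretch the cardinality grows, and it is
-- bounded by k.)
stationary : ∀ {k} (X : ℕ → Fin k → Bool) →
             (∀ j x → X j x ≡ true → X (suc j) x ≡ true) →
             ∃[ j ] (∀ x → X (suc j) x ≡ true → X j x ≡ true)
stationary {k} X ascending = conclude (climb (suc k))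
  where
  asSubset : ∀ j → Subset k
  asSubset j = tabulate (X j)

  Step : Set
  Step = ∃[ j ] (∀ x → X (suc j) x ≡ true → X j x ≡ true)

  into : ∀ {j y} → X j y ≡ true → y ∈ˢ asSubset j
  into {j} {y} h = lookup⇒[]= y (asSubset j) (trans (lookup∘tabulate (X j) y) h)

  outOf : ∀ {j y} → y ∈ˢ asSubset j → X j y ≡ true
  outOf {j} {y} h = trans (sym (lookup∘tabulate (X j) y)) ([]=⇒lookup h)

  -- after t steps, either a stationary step occurred or the set has ≥ t elements
  climb : ∀ t → Step ⊎ (t ℕ.≤ ∣ asSubset t ∣)
  climb zero = inj₂ z≤n
  climb (suc t) with climb t
  ... | inj₁ step = inj₁ step
  ... | inj₂ t≤∣Xt∣ with any? (λ x → (X (suc t) x BoolP.≟ true) ×-dec (X t x BoolP.≟ false))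
  ...   | no noNew = inj₁ (t , λ x new → ¬-not (λ old → noNew (x , new , old)))
  ...   | yes (x , new , old) = inj₂ (ℕP.≤-trans (s≤s t≤∣Xt∣) (p⊂q⇒∣p∣<∣q∣ strict))
    where
    strict : asSubset t ⊂ asSubset (suc t)
    strict = (λ h → into (ascending t _ (outOf h))) , x , into new , (λ h → BoolP.not-¬ old (outOf h))

  conclude : Step ⊎ (suc k ℕ.≤ ∣ asSubset (suc k) ∣) → Step
  conclude (inj₁ step)     = step
  conclude (inj₂ tooLarge) = ⊥-elim (ℕP.<-irrefl refl (ℕP.≤-trans tooLarge (∣p∣≤n (asSubset (suc k)))))

record ComponentOf (G : Graph) (S : NodeSet G) (u : Fin (n G)) : Set where
  field
    nodes     : NodeSet G
    contains  : nodes u ≡ true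
    reachable : ∀ w → nodes w ≡ true → Reach G S u w
    closed    : ∀ e → S (end₁ G e) ≡ true → S (end₂ G e) ≡ true →
                nodes (end₁ G e) ≡ nodes (end₂ G e)

module BreadthFirst (G : Graph) (S : NodeSet G) (u : Fin (n G)) (u∈S : S u ≡ true) where

  Enters : NodeSet G → Fin (m G) → Fin (n G) → Set
  Enters R e w = S (end₁ G e) ≡ true × S (end₂ G e) ≡ true ×
    ((R (end₁ G e) ≡ true × end₂ G e ≡ w) ⊎ (R (end₂ G e) ≡ true × end₁ G e ≡ w))

  enters? : ∀ R e w → Dec (Enters R e w)
  enters? R e w =
    (S (end₁ G e) BoolP.≟ true) ×-dec (S (end₂ G e) BoolP.≟ true) ×-dec
    (((R (end₁ G e) BoolP.≟ true) ×-dec (end₂ G e ≟ᶠ w)) ⊎-dec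
     ((R (end₂ G e) BoolP.≟ true) ×-dec (end₁ G e ≟ᶠ w)))

  expand : NodeSet G → NodeSet G
  expand R w = R w ∨ does (any? (λ e → enters? R e w))

  expand-⊇ : ∀ R w → R w ≡ true → expand R w ≡ true
  expand-⊇ R w w∈R rewrite w∈R = refl

  expand-enters : ∀ R e w → Enters R e w → expand R w ≡ true
  expand-enters R e w entering with R w
  ... | true = refl
  ... | false with any? (λ e → enters? R e w)
  ...   | yes _    = refl
  ...   | no never = ⊥-elim (never (e , entering))

  expand-cases : ∀ R w → expand R w ≡ true → R w ≡ true ⊎ ∃[ e ] Enters R e w
  expand-cases R w _ with R w
  ... | true = inj₁ refl
  ... | false with any? (λ e → enters? R e w)
  ...   | yes entering = inj₂ entering
  expand-cases R w () | false | no _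

  ball : ℕ → NodeSet G
  ball zero    w = does (w ≟ᶠ u)
  ball (suc k)   = expand (ball k)

  ball-center : ∀ k → ball k u ≡ true
  ball-center zero with u ≟ᶠ u
  ... | yes _ = refl
  ... | no u≢u = ⊥-elim (u≢u refl)
  ball-center (suc k) = expand-⊇ (ball k) u (ball-center k)

  ball-reachable : ∀ k w → ball k w ≡ true → Reach G S u w
  ball-reachable zero w _ with w ≟ᶠ u
  ... | yes refl = here u∈S
  ball-reachable zero w () | no _
  ball-reachable (suc k) w found with expand-cases (ball k) w found
  ... | inj₁ earlier = ball-reachable k w earlier
  ... | inj₂ (e , s₁ , s₂ , inj₁ (r₁ , refl)) =
    reach-trans (ball-reachable k _ r₁) (step₁₂ e s₁ s₂ (here s₂))
  ... | inj₂ (e , s₁ , s₂ , inj₂ (r₂ , refl)) =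
    reach-trans (ball-reachable k _ r₂) (step₂₁ e s₁ s₂ (here s₁))

  component : ComponentOf G S u
  component with stationary ball (λ k → expand-⊇ (ball k))
  ... | j , stable = record
    { nodes     = ball j
    ; contains  = ball-center j
    ; reachable = ball-reachable j
    ; closed    = λ e s₁ s₂ → bool-antisym
        (λ r₁ → stable _ (expand-enters (ball j) e _ (s₁ , s₂ , inj₁ (r₁ , refl))))
        (λ r₂ → stable _ (expand-enters (ball j) e _ (s₁ , s₂ , inj₂ (r₂ , refl))))
    }

-- If every cut weighs at least λ > 0, both sides of a minimum cut induce
-- connected subgraphs: otherwise the component A ∌ v of some u would be a
-- lighter shore.
minimumShore-connected : ∀ G c λ₀ → 0ℚ < λ₀ → (∀ T → NonTrivial G T → λ₀ ≤ cδ G c T) →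
                         ∀ P → MinimumShore G c P → InducedConnected G P
minimumShore-connected G c λ₀ 0<λ₀ lowerBound P minimum u v u∈P v∈P
  with BreadthFirst.component G P u u∈P
... | C with ComponentOf.nodes C v in v∈?C
...   | true  = ComponentOf.reachable C v v∈?C
...   | false = ⊥-elim (ℚP.<-irrefl refl (ℚP.<-≤-trans lighter (minimum A ((u , u∈A) , (v , v∈?C)))))
  where
  open ComponentOf C renaming (nodes to A; contains to u∈A)
  A⊆P : ∀ w → A w ≡ true → P w ≡ true
  A⊆P w w∈A = reach-target (reachable w w∈A)
  rest : NonTrivial G (_∖_ G P A)
  rest = (v , cong₂ (λ p a → p ∧ not a) v∈P v∈?C) ,
         (u , trans (cong (λ a → P u ∧ not a) u∈A) (BoolP.∧-zeroʳ (P u)))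
  lighter : cδ G c A < cδ G c P
  lighter = split-lighter G c λ₀ 0<λ₀ lowerBound P A A⊆P closed rest

lemma2p4 : (G : Graph) (c : Vec𝔼 G) (λ₀ : ℚ) →
    FacetDefining G c λ₀ → 0ℚ < λ₀ → (∀ e → ¬ (c e ≡ 0ℚ)) →
    (ℱ : Fin (m G) → NodeSet G) → BasisOfMinCuts G c ℱ →
    ((∀ i → InducedConnected G (ℱ i) × InducedConnected G (∁ {G} (ℱ i))) ×
     Simple G ×
     (∀ e → ∃[ i ] (_∈δ_ {G} e (ℱ i))))
lemma2p4 G c λ₀ (valid , _ , _) 0<λ₀ _ ℱ (minimumCuts , independent) =
  connected , (noLoops , independentCuts-noParallel G ℱ independent) , covered
  where
  shoreConnected : ∀ P → MinimumShore G c P → InducedConnected G P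
  shoreConnected = minimumShore-connected G c λ₀ 0<λ₀ (valid⇒lowerBound G c λ₀ valid)

  connected : ∀ i → InducedConnected G (ℱ i) × InducedConnected G (∁ {G} (ℱ i))
  connected i = shoreConnected (ℱ i) minimal ,
                shoreConnected (∁ {G} (ℱ i)) (complement-minimum G c (ℱ i) minimal)
    where minimal = proj₂ (minimumCuts i)

  covered : ∀ e → ∃[ i ] (_∈δ_ {G} e (ℱ i))
  covered = independentCuts-cover G ℱ independent

  noLoops : ∀ e → ¬ (end₁ G e ≡ end₂ G e)
  noLoops e loop with covered e
  ... | i , e∈δ with trans (sym e∈δ) (δ-loop G (ℱ i) e loop)
  ...   | ()
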